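{- Let $G = C_n^k$ be the $k$-th power of the cycle $C_n$, with $n \ge 4$ and $2 \le k < n/2$. Then $G$ is gap-vertex-labelable if and only if either (i) $G$ is isomorphic to $C_6^2$ or $C_7^2$; or (ii) $n \ge 8$ and $k \le \lfloor n/4 \rfloor$.
   Context: $C_n$ is the cycle on $n$ vertices. The $k$-th power $H^k$ of a graph $H$ has vertex set $V(H)$ and edges $uv$ for all distinct $u,v$ with $\mathrm{dist}_H(u,v) \le k$. For $m \in \mathbb{N}$ and $[m] = \{1, \ldots, m\}$, a gap-$[m]$-vertex-labelling of a connected graph $G$ is a pair $(\pi, c_\pi)$ where $\pi : V(G) \to [m]$ and $c_\pi : V(G) \to \{0, 1, \ldots, m\}$ is a proper vertex colouring of $G$ such that for every $v \in V(G)$: if $d(v) \ge 2$ then $c_\pi(v) = \max_{u \in N(v)} \pi(u) - \min_{u \in N(v)} \pi(u)$, and if $d(v) = 1$ then $c_\pi(v) = \pi(u)$ where $u$ is the unique neighbour of $v$. $G$ is gap-vertex-labelable if it admits a gap-$[m]$-vertex-labelling for some $m \in \mathbb{N}$. -}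

module Defs where

open import Data.Nat using (ℕ; zero; suc; _≤_; _⊓_; _⊔_; _∸_; ∣_-_∣; _≤ᵇ_; _<_)
open import Data.Bool using (Bool; true; false; _∧_; not; T)
open import Data.Fin using (Fin; toℕ; _≟_)
open import Data.List using (List; []; _∷_; foldr; filterᵇ; map; length; allFin)
open import Data.Product using (Σ; _×_; _,_)
open import Relation.Nullary.Decidable using (⌊_⌋)
open import Relation.Binary.PropositionalEquality using (_≡_; _≢_)

record Graph : Set where
  field
    V   : ℕ
    adj : Fin V → Fin V → Bool
open Graph public

cycDist : (n : ℕ) → Fin n → Fin n → ℕ
cycDist n i j = ∣ toℕ i - toℕ j ∣ ⊓ (n ∸ ∣ toℕ i - toℕ j ∣)

CyclePower : ℕ → ℕ → Graph
CyclePower n k = record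
  { V = n
  ; adj = λ i j → not ⌊ i ≟ j ⌋ ∧ (cycDist n i j ≤ᵇ k) }

nbrs : (G : Graph) → Fin (V G) → List (Fin (V G))
nbrs G v = filterᵇ (adj G v) (allFin (V G))

deg : (G : Graph) → Fin (V G) → ℕ
deg G v = length (nbrs G v)

maxList : List ℕ → ℕ
maxList = foldr _⊔_ 0

-- minimum of a list (only used on non-empty lists)
minList : List ℕ → ℕ
minList []       = 0
minList (x ∷ xs) = foldr _⊓_ x xs

record GapLabelling (G : Graph) (m : ℕ) : Set where
  field
    π        : Fin (V G) → ℕ
    c        : Fin (V G) → ℕ
    π-range  : ∀ v → 1 ≤ π v × π v ≤ m
    c-range  : ∀ v → c v ≤ m
    proper   : ∀ u v → T (adj G u v) → c u ≢ c v
    gap-rule : ∀ v → 2 ≤ deg G v →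
               c v ≡ maxList (map π (nbrs G v)) ∸ minList (map π (nbrs G v))
    leaf-rule : ∀ v u → nbrs G v ≡ u ∷ [] → c v ≡ π u

GapVertexLabelable : Graph → Set
GapVertexLabelable G = Σ ℕ λ m → GapLabelling G m

record Iso (G H : Graph) : Set where
  field
    to       : Fin (V G) → Fin (V H)
    from     : Fin (V H) → Fin (V G)
    from-to  : ∀ x → from (to x) ≡ x
    to-from  : ∀ y → to (from y) ≡ y
    adj-pres : ∀ u v → adj H (to u) (to v) ≡ adj G u v

-- If any two vertices x, y of a simple graph have two adjacent common neighbours w₁, w₂, it has no
-- gap labelling: taking x and y of largest and smallest label, both w₁ and w₂ get colour max π − min π.
-- In C_n^k this happens when k ≥ 3 and n < 4k (explicit offsets along the cycle) and for C₅² = K₅,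
-- leaving only C₆² and C₇², which are labelled explicitly.
--
-- For n ≥ 4k, label position i by 2^e(i), where e is injective, minimal at 0, maximal at 2k and strictly
-- monotone on the two arcs between them. A gap 2^a − 2^b (b < a) determines a and b, so adjacent u, v
-- with equal colour share the maximiser X and minimiser B of the labels on their neighbourhoods. Both
-- are common neighbours of u and v, so X ± 1 and B ± 1 lie in N[u] ∪ N[v]; hence X and B are local
-- extrema of e, at positions 2k and 0. But when n ≥ 4k no two adjacent vertices are both adjacent to
-- positions 0 and 2k.

module Submission where

open import Defs
open import Data.Nat using (ℕ; zero; suc; _+_; _*_; _^_; _∸_; _/_; _≤_; _<_; _⊓_; ∣_-_∣; _≤ᵇ_; z≤n; s≤s; _≤?_; _<?_)
open import Data.Nat.Properties
open import Data.Bool using (T; not; _∧_)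
open import Data.Unit using (tt)
open import Data.Fin using (Fin; toℕ; #_) renaming (_≟_ to _≟ᶠ_)
open import Data.Fin.Properties using (toℕ-injective; toℕ<n; toℕ-fromℕ<; all?; any?; injective⇒≤)
open import Data.Nat.DivMod
  using (_%_; _mod_; m<n⇒m%n≡m; [m+n]%n≡m%n; %-distribˡ-+; m%n%n≡m%n; m*n/n≡m; m/n*n≤m; /-monoˡ-≤)
open import Data.List using (List; []; _∷_; foldr; map; length; allFin; lookup)
open import Data.List.Extrema.Nat using (argmax; argmin; argmax-sel; argmin-sel; f[xs]≤f[argmax]; f[argmin]≤f[xs])
open import Data.List.Membership.Propositional using (_∈_)
open import Data.List.Membership.Propositional.Properties using (∈-allFin; ∈-filter⁺; ∈-filter⁻)
open import Data.List.Relation.Unary.All as All using ()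
open import Data.List.Relation.Unary.Any using (here; there)
open import Data.Product using (∃; ∃₂; ∃-syntax; _×_; _,_; proj₁; proj₂)
open import Data.Sum using (_⊎_; inj₁; inj₂; swap)
open import Data.Empty using (⊥; ⊥-elim)
open import Function using (_∘_; id)
open import Function.Bundles using (_⇔_; mk⇔; Equivalence)
open import Data.Nat.Tactic.RingSolver using (solve-∀)
open import Relation.Nullary using (¬_; yes; no)
open import Relation.Binary using (tri<; tri≈; tri>)
open import Relation.Nullary.Decidable using (Dec; T?; ⌊_⌋; map′; toWitness; _×-dec_; _→-dec_; ¬?)
open import Relation.Binary.PropositionalEquality
  using (_≡_; _≢_; refl; sym; trans; cong; cong₂; subst; subst₂; module ≡-Reasoning)

selected-∈ : ∀ {A : Set} {a x : A} {xs} → x ∈ xs → (a ≡ x) ⊎ (a ∈ xs) → a ∈ xs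
selected-∈ x∈xs (inj₁ refl) = x∈xs
selected-∈ _    (inj₂ a∈xs) = a∈xs

module _ {A : Set} (f : A → ℕ) where

  Maximises Minimises : List A → A → Set
  Maximises xs a = a ∈ xs × (∀ {y} → y ∈ xs → f y ≤ f a)
  Minimises xs a = a ∈ xs × (∀ {y} → y ∈ xs → f a ≤ f y)

  maximiser : ∀ {x} xs → x ∈ xs → ∃ (Maximises xs)
  maximiser {x} xs x∈xs = argmax f x xs , selected-∈ x∈xs (argmax-sel f x xs) , All.lookup (f[xs]≤f[argmax] x xs)

  minimiser : ∀ {x} xs → x ∈ xs → ∃ (Minimises xs)
  minimiser {x} xs x∈xs = argmin f x xs , selected-∈ x∈xs (argmin-sel f x xs) , All.lookup (f[argmin]≤f[xs] x xs)

  maxList-map-≤ : ∀ {b} xs → (∀ {y} → y ∈ xs → f y ≤ b) → maxList (map f xs) ≤ b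
  maxList-map-≤ []       _  = z≤n
  maxList-map-≤ (y ∷ ys) ub = ⊔-lub (ub (here refl)) (maxList-map-≤ ys (ub ∘ there))

  maxList-map-≥ : ∀ {a xs} → a ∈ xs → f a ≤ maxList (map f xs)
  maxList-map-≥ (here refl) = m≤m⊔n _ _
  maxList-map-≥ (there a∈)  = ≤-trans (maxList-map-≥ a∈) (m≤n⊔m _ _)

  maxList-map : ∀ {xs a} → Maximises xs a → maxList (map f xs) ≡ f a
  maxList-map {xs} (a∈xs , max) = ≤-antisym (maxList-map-≤ xs max) (maxList-map-≥ a∈xs)

  minList-map : ∀ {xs a} → Minimises xs a → minList (map f xs) ≡ f a
  minList-map {y ∷ ys} {a} (a∈xs , min) = ≤-antisym (lower a∈xs) (greatest ys (min (here refl)) (min ∘ there))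
    where
    lower : ∀ {z zs} → a ∈ z ∷ zs → foldr _⊓_ (f z) (map f zs) ≤ f a
    lower {zs = []}     (here refl)         = ≤-refl
    lower {zs = _ ∷ zs} (here refl)         = ≤-trans (m⊓n≤n _ _) (lower {zs = zs} (here refl))
    lower {zs = _ ∷ _}  (there (here refl)) = m⊓n≤m _ _
    lower {zs = _ ∷ zs} (there (there a∈))  = ≤-trans (m⊓n≤n _ _) (lower {zs = zs} (there a∈))
    greatest : ∀ zs → f a ≤ f y → (∀ {z} → z ∈ zs → f a ≤ f z) → f a ≤ foldr _⊓_ (f y) (map f zs)
    greatest []       a≤y _  = a≤y
    greatest (z ∷ zs) a≤y lb = ⊓-glb (lb (here refl)) (greatest zs a≤y (lb ∘ there))

-- Gap labellings of simple graphs

distinct-∈⇒2≤length : ∀ {A : Set} {a b : A} {xs} → a ∈ xs → b ∈ xs → a ≢ b → 2 ≤ length xs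
distinct-∈⇒2≤length {xs = _ ∷ []}    (here refl) (here refl) a≢b = ⊥-elim (a≢b refl)
distinct-∈⇒2≤length {xs = _ ∷ _ ∷ _} _           _           _   = s≤s (s≤s z≤n)

record Adjacent (G : Graph) (u v : Fin (V G)) : Set where
  constructor adjacent
  field isAdjacent : T (adj G u v)
open Adjacent

record IsSimple (G : Graph) : Set where
  field
    irreflexive : ∀ {v} → ¬ Adjacent G v v
    symmetric   : ∀ {u v} → Adjacent G u v → Adjacent G v u

module _ (G : Graph) where

  ∈-nbrs⁺ : ∀ {v u} → Adjacent G v u → u ∈ nbrs G v
  ∈-nbrs⁺ {v} {u} (adjacent vu) = ∈-filter⁺ (T? ∘ adj G v) (∈-allFin u) vu

  ∈-nbrs⁻ : ∀ {v u} → u ∈ nbrs G v → Adjacent G v u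
  ∈-nbrs⁻ {v} = adjacent ∘ proj₂ ∘ ∈-filter⁻ (T? ∘ adj G v) {xs = allFin (V G)}

  2≤deg : ∀ {v x y} → Adjacent G v x → Adjacent G v y → x ≢ y → 2 ≤ deg G v
  2≤deg vx vy = distinct-∈⇒2≤length (∈-nbrs⁺ vx) (∈-nbrs⁺ vy)

  AdjacentCommonNeighbours : Fin (V G) → Fin (V G) → Set
  AdjacentCommonNeighbours x y =
    ∃₂ λ w₁ w₂ → Adjacent G w₁ w₂ × (Adjacent G w₁ x × Adjacent G w₁ y) × (Adjacent G w₂ x × Adjacent G w₂ y)

  adjacent? : ∀ u v → Dec (Adjacent G u v)
  adjacent? u v = map′ adjacent isAdjacent (T? (adj G u v))

  adjacentCommonNeighbours? : ∀ x y → Dec (AdjacentCommonNeighbours x y)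
  adjacentCommonNeighbours? x y = any? λ w₁ → any? λ w₂ →
    adjacent? w₁ w₂ ×-dec (adjacent? w₁ x ×-dec adjacent? w₁ y) ×-dec (adjacent? w₂ x ×-dec adjacent? w₂ y)

  adjacentCommonNeighbours-sym : ∀ {x y} → AdjacentCommonNeighbours x y → AdjacentCommonNeighbours y x
  adjacentCommonNeighbours-sym (w₁ , w₂ , w₁w₂ , (w₁x , w₁y) , (w₂x , w₂y)) =
    w₁ , w₂ , w₁w₂ , (w₁y , w₁x) , (w₂y , w₂x)

gap : (G : Graph) → (Fin (V G) → ℕ) → Fin (V G) → ℕ
gap G π v = maxList (map π (nbrs G v)) ∸ minList (map π (nbrs G v))

gap-at-extremes : ∀ G π w {X B} → Maximises π (nbrs G w) X → Minimises π (nbrs G w) B → gap G π w ≡ π X ∸ π B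
gap-at-extremes G π w maxX minB = cong₂ _∸_ (maxList-map π maxX) (minList-map π minB)

gapLabelling : ∀ G m (π : Fin (V G) → ℕ) → (∀ v → 2 ≤ deg G v) → (∀ v → 1 ≤ π v × π v ≤ m) →
               (∀ {u v} → Adjacent G u v → gap G π u ≢ gap G π v) → GapLabelling G m
gapLabelling G m π 2≤deg π-range proper = record
  { π         = π
  ; c         = gap G π
  ; π-range   = π-range
  ; c-range   = λ v → ≤-trans (m∸n≤m _ (minList (map π (nbrs G v))))
                               (maxList-map-≤ π (nbrs G v) (λ {y} _ → proj₂ (π-range y)))
  ; proper    = λ _ _ uv → proper (adjacent uv)
  ; gap-rule  = λ _ _ → refl
  ; leaf-rule = λ v _ nbrs≡[u] → ⊥-elim (<⇒≱ (s≤s (s≤s z≤n)) (subst (λ l → 2 ≤ length l) nbrs≡[u] (2≤deg v)))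
  }

module _ {G : Graph} {m : ℕ} (L : GapLabelling G m) where
  open GapLabelling L

  gap-at-global-extremes : ∀ {w x y z} → (∀ u → π u ≤ π x) → (∀ u → π y ≤ π u) →
                           Adjacent G w x → Adjacent G w y → Adjacent G w z → z ≢ x → c w ≡ π x ∸ π y
  gap-at-global-extremes max min wx wy wz z≢x =
    trans (gap-rule _ (2≤deg G wz wx z≢x))
          (gap-at-extremes G π _ (∈-nbrs⁺ G wx , λ _ → max _) (∈-nbrs⁺ G wy , λ _ → min _))

¬labelable-if-adjacent-common-neighbours : ∀ G → IsSimple G → Fin (V G) →
  (∀ x y → AdjacentCommonNeighbours G x y) → ¬ GapVertexLabelable G
¬labelable-if-adjacent-common-neighbours G simple v₀ acn (_ , L) =
  contradiction (maximiser π _ (∈-allFin v₀)) (minimiser π _ (∈-allFin v₀))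
  where
  open GapLabelling L
  open IsSimple simple
  contradiction : ∃ (Maximises π (allFin (V G))) → ∃ (Minimises π (allFin (V G))) → ⊥
  contradiction (x , _ , max) (y , _ , min) with acn x y
  ... | w₁ , w₂ , w₁w₂ , (w₁x , w₁y) , (w₂x , w₂y) = proper w₁ w₂ (isAdjacent w₁w₂) (trans
          (gap-at-global-extremes L max′ min′ w₁x w₁y w₁w₂ λ { refl → irreflexive w₂x })
          (sym (gap-at-global-extremes L max′ min′ w₂x w₂y (symmetric w₁w₂) λ { refl → irreflexive w₁x })))
    where
    max′ : ∀ u → π u ≤ π x
    max′ u = max (∈-allFin u)
    min′ : ∀ u → π y ≤ π u
    min′ u = min (∈-allFin u)

-- Differences of powers of two

2^-reflects-≤ : ∀ {a b} → 2 ^ a ≤ 2 ^ b → a ≤ b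
2^-reflects-≤ {a} {b} 2^a≤2^b with a ≤? b
... | yes a≤b = a≤b
... | no  a≰b = ⊥-elim (<⇒≱ (^-monoʳ-< 2 (s≤s (s≤s z≤n)) (≰⇒> a≰b)) 2^a≤2^b)

2^-reflects-< : ∀ {a b} → 2 ^ a < 2 ^ b → a < b
2^-reflects-< {a} {b} 2^a<2^b with a <? b
... | yes a<b = a<b
... | no  a≮b = ⊥-elim (≤⇒≯ (^-monoʳ-≤ 2 (≮⇒≥ a≮b)) 2^a<2^b)

2^-injective : ∀ {a b} → 2 ^ a ≡ 2 ^ b → a ≡ b
2^-injective e = ≤-antisym (2^-reflects-≤ (≤-reflexive e)) (2^-reflects-≤ (≤-reflexive (sym e)))

-- Since 2^(c-1) ≤ 2^c - 2^d, the difference 2^a - 2^b (b < a) determines its leading exponent a.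
2^∸2^-mono-< : ∀ {a b c d} → b < a → d < c → a < c → 2 ^ a ∸ 2 ^ b < 2 ^ c ∸ 2 ^ d
2^∸2^-mono-< {a} {b} {suc c} {d} b<a (s≤s d≤c) (s≤s a≤c) = begin-strict
  2 ^ a ∸ 2 ^ b             <⟨ ∸-monoʳ-< (m^n>0 2 b) (^-monoʳ-≤ 2 (<⇒≤ b<a)) ⟩
  2 ^ a                     ≤⟨ ^-monoʳ-≤ 2 a≤c ⟩
  2 ^ c                     ≤⟨ m≤m+n (2 ^ c) _ ⟩
  2 ^ c + (2 ^ c + 0 ∸ 2 ^ d) ≡⟨ +-∸-assoc (2 ^ c) (≤-trans (^-monoʳ-≤ 2 d≤c) (m≤m+n (2 ^ c) 0)) ⟨
  2 ^ suc c ∸ 2 ^ d          ∎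
  where open ≤-Reasoning

2^∸2^-injective : ∀ {a b c d} → b < a → d < c → 2 ^ a ∸ 2 ^ b ≡ 2 ^ c ∸ 2 ^ d → a ≡ c × b ≡ d
2^∸2^-injective {a} {b} {c} {d} b<a d<c eq with <-cmp a c
... | tri< a<c _ _ = ⊥-elim (<-irrefl eq (2^∸2^-mono-< b<a d<c a<c))
... | tri> _ _ c<a = ⊥-elim (<-irrefl (sym eq) (2^∸2^-mono-< d<c b<a c<a))
... | tri≈ _ refl _ = refl , 2^-injective (∸-cancelˡ-≡ (^-monoʳ-≤ 2 (<⇒≤ b<a)) (^-monoʳ-≤ 2 (<⇒≤ d<c)) eq)

-- Powers of cycles

adjacent⁺ : ∀ {n k} {u v : Fin n} → u ≢ v → cycDist n u v ≤ k → Adjacent (CyclePower n k) u v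
adjacent⁺ {n} {k} {u} {v} u≢v d≤k = adjacent unfolded
  where
  unfolded : T (not ⌊ u ≟ᶠ v ⌋ ∧ (cycDist n u v ≤ᵇ k))
  unfolded with u ≟ᶠ v
  ... | yes u≡v = ⊥-elim (u≢v u≡v)
  ... | no  _   = ≤⇒≤ᵇ d≤k

adjacent⁻ : ∀ {n k} {u v : Fin n} → Adjacent (CyclePower n k) u v → u ≢ v × cycDist n u v ≤ k
adjacent⁻ {n} {k} {u} {v} (adjacent uv) = unfold uv
  where
  unfold : T (not ⌊ u ≟ᶠ v ⌋ ∧ (cycDist n u v ≤ᵇ k)) → u ≢ v × cycDist n u v ≤ k
  unfold uv with u ≟ᶠ v
  ... | no u≢v = u≢v , ≤ᵇ⇒≤ _ _ uv

cyclePower-isSimple : ∀ n k → IsSimple (CyclePower n k)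
cyclePower-isSimple n k = record
  { irreflexive = λ vv → proj₁ (adjacent⁻ vv) refl
  ; symmetric   = λ {u} {v} uv → adjacent⁺ (proj₁ (adjacent⁻ uv) ∘ sym)
                     (subst (_≤ k) (cong (λ d → d ⊓ (n ∸ d)) (∣-∣-comm (toℕ u) (toℕ v))) (proj₂ (adjacent⁻ uv)))
  }

module Cycle (m : ℕ) where

  N : ℕ
  N = suc m

  infixl 6 _⊕_
  _⊕_ : Fin N → ℕ → Fin N
  x ⊕ t = (toℕ x + t) mod N

  toℕ-⊕ : ∀ x t → toℕ (x ⊕ t) ≡ (toℕ x + t) % N
  toℕ-⊕ x t = toℕ-fromℕ< _

  -- a + t ≡ b modulo N with at most one wrap-around; this is how ⊕ acts on toℕ when t ≤ N.
  ShiftsTo : ℕ → ℕ → ℕ → Set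
  ShiftsTo a t b = (a + t ≡ b) ⊎ (a + t ≡ b + N)

  shiftsTo-% : ∀ a t → a < N → t ≤ N → ShiftsTo a t ((a + t) % N)
  shiftsTo-% a t a<N t≤N with a + t <? N
  ... | yes a+t<N = inj₁ (sym (m<n⇒m%n≡m a+t<N))
  ... | no  a+t≮N = inj₂ (begin
          a + t                ≡⟨ m+[n∸m]≡n N≤a+t ⟨
          N + d                ≡⟨ +-comm N d ⟩
          d + N                ≡⟨ cong (_+ N) (m<n⇒m%n≡m d<N) ⟨
          d % N + N            ≡⟨ cong (_+ N) ([m+n]%n≡m%n d N) ⟨
          (d + N) % N + N      ≡⟨ cong (λ z → z % N + N) (trans (+-comm d N) (m+[n∸m]≡n N≤a+t)) ⟩
          (a + t) % N + N      ∎)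
    where
    open ≡-Reasoning
    N≤a+t = ≮⇒≥ a+t≮N
    d = a + t ∸ N
    d<N : d < N
    d<N = +-cancelˡ-< N d N (subst (_< N + N) (sym (m+[n∸m]≡n N≤a+t)) (+-mono-<-≤ a<N t≤N))

  %-shiftsTo : ∀ a t b → b < N → ShiftsTo a t b → (a + t) % N ≡ b
  %-shiftsTo a t b b<N (inj₁ e) = trans (cong (_% N) e) (m<n⇒m%n≡m b<N)
  %-shiftsTo a t b b<N (inj₂ e) = trans (cong (_% N) e) (trans ([m+n]%n≡m%n b N) (m<n⇒m%n≡m b<N))

  ⊕-shiftsTo : ∀ x t → t ≤ N → ShiftsTo (toℕ x) t (toℕ (x ⊕ t))
  ⊕-shiftsTo x t t≤N = subst (ShiftsTo (toℕ x) t) (sym (toℕ-⊕ x t)) (shiftsTo-% (toℕ x) t (toℕ<n x) t≤N)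

  shiftsTo-⊕ : ∀ x t y → ShiftsTo (toℕ x) t (toℕ y) → x ⊕ t ≡ y
  shiftsTo-⊕ x t y s = toℕ-injective (trans (toℕ-⊕ x t) (%-shiftsTo (toℕ x) t (toℕ y) (toℕ<n y) s))

  ⊕-assoc : ∀ x s t → x ⊕ s ⊕ t ≡ x ⊕ (s + t)
  ⊕-assoc x s t = toℕ-injective (begin
      toℕ (x ⊕ s ⊕ t)                   ≡⟨ toℕ-⊕ (x ⊕ s) t ⟩
      (toℕ (x ⊕ s) + t) % N             ≡⟨ cong (λ z → (z + t) % N) (toℕ-⊕ x s) ⟩
      ((toℕ x + s) % N + t) % N         ≡⟨ %-distribˡ-+ ((toℕ x + s) % N) t N ⟩
      ((toℕ x + s) % N % N + t % N) % N ≡⟨ cong (λ z → (z + t % N) % N) (m%n%n≡m%n (toℕ x + s) N) ⟩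
      ((toℕ x + s) % N + t % N) % N     ≡⟨ %-distribˡ-+ (toℕ x + s) t N ⟨
      (toℕ x + s + t) % N               ≡⟨ cong (_% N) (+-assoc (toℕ x) s t) ⟩
      (toℕ x + (s + t)) % N             ≡⟨ toℕ-⊕ x (s + t) ⟨
      toℕ (x ⊕ (s + t))                 ∎)
    where open ≡-Reasoning

  ⊕-identityʳ : ∀ x → x ⊕ 0 ≡ x
  ⊕-identityʳ x = shiftsTo-⊕ x 0 x (inj₁ (+-identityʳ (toℕ x)))

  ⊕-N : ∀ x → x ⊕ N ≡ x
  ⊕-N x = shiftsTo-⊕ x N x (inj₂ refl)

  ⊕-swap : ∀ x s t → x ⊕ s ⊕ t ≡ x ⊕ t ⊕ s
  ⊕-swap x s t = trans (⊕-assoc x s t) (trans (cong (x ⊕_) (+-comm s t)) (sym (⊕-assoc x t s)))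

  ⊕-m-suc : ∀ x i → x ⊕ m ⊕ suc i ≡ x ⊕ i
  ⊕-m-suc x i = begin
    x ⊕ m ⊕ suc i   ≡⟨ ⊕-assoc x m (suc i) ⟩
    x ⊕ (m + suc i) ≡⟨ cong (x ⊕_) (+-suc m i) ⟩
    x ⊕ (N + i)     ≡⟨ ⊕-assoc x N i ⟨
    x ⊕ N ⊕ i       ≡⟨ cong (_⊕ i) (⊕-N x) ⟩
    x ⊕ i           ∎
    where open ≡-Reasoning

  ⊕-cancelˡ : ∀ x {s t} → s < N → t < N → x ⊕ s ≡ x ⊕ t → s ≡ t
  ⊕-cancelˡ x {s} {t} s<N t<N eq =
    cancel (⊕-shiftsTo x s (<⇒≤ s<N)) (subst (ShiftsTo a t) (cong toℕ (sym eq)) (⊕-shiftsTo x t (<⇒≤ t<N)))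
    where
    a = toℕ x
    b = toℕ (x ⊕ s)
    wrap-too-large : ∀ {u v} → v < N → a + u ≡ b → a + v ≡ b + N → ⊥
    wrap-too-large {u} {v} v<N e₁ e₂ = <-irrefl refl (begin-strict
      a + v      <⟨ +-monoʳ-< a v<N ⟩
      a + N      ≤⟨ +-monoˡ-≤ N (m≤m+n a u) ⟩
      a + u + N  ≡⟨ cong (_+ N) e₁ ⟩
      b + N      ≡⟨ e₂ ⟨
      a + v      ∎)
      where open ≤-Reasoning
    cancel : ShiftsTo a s b → ShiftsTo a t b → s ≡ t
    cancel (inj₁ e₁) (inj₁ e₂) = +-cancelˡ-≡ a s t (trans e₁ (sym e₂))
    cancel (inj₂ e₁) (inj₂ e₂) = +-cancelˡ-≡ a s t (trans e₁ (sym e₂))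
    cancel (inj₁ e₁) (inj₂ e₂) = ⊥-elim (wrap-too-large t<N e₁ e₂)
    cancel (inj₂ e₁) (inj₁ e₂) = ⊥-elim (wrap-too-large s<N e₂ e₁)

  ⊕-≢ : ∀ x {t} → 0 < t → t < N → x ⊕ t ≢ x
  ⊕-≢ x 0<t t<N eq = <⇒≢ 0<t (sym (⊕-cancelˡ x t<N (s≤s z≤n) (trans eq (sym (⊕-identityʳ x)))))

  ⊕-surjective : ∀ x y → ∃[ d ] d < N × y ≡ x ⊕ d
  ⊕-surjective x y with ≤-total (toℕ x) (toℕ y)
  ... | inj₁ x≤y = d , d<N , sym (shiftsTo-⊕ x d y (inj₁ (m+[n∸m]≡n x≤y)))
    where
    d = toℕ y ∸ toℕ x
    d<N = ≤-<-trans (m∸n≤m (toℕ y) (toℕ x)) (toℕ<n y)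
  ... | inj₂ y≤x with toℕ x ≟ toℕ y
  ...   | yes x≡y = 0 , s≤s z≤n , sym (trans (⊕-identityʳ x) (toℕ-injective x≡y))
  ...   | no  x≢y = N ∸ e , ∸-monoʳ-< 0<e (<⇒≤ e<N) , sym (shiftsTo-⊕ x (N ∸ e) y (inj₂ wrap))
    where
    e = toℕ x ∸ toℕ y
    e<N : e < N
    e<N = ≤-<-trans (m∸n≤m (toℕ x) (toℕ y)) (toℕ<n x)
    0<e : 0 < e
    0<e = m<n⇒0<n∸m (≤∧≢⇒< y≤x (x≢y ∘ sym))
    wrap : toℕ x + (N ∸ e) ≡ toℕ y + N
    wrap = begin
      toℕ x + (N ∸ e)         ≡⟨ cong (_+ (N ∸ e)) (m+[n∸m]≡n y≤x) ⟨
      toℕ y + e + (N ∸ e)     ≡⟨ +-assoc (toℕ y) e (N ∸ e) ⟩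
      toℕ y + (e + (N ∸ e))   ≡⟨ cong (toℕ y +_) (m+[n∸m]≡n (<⇒≤ e<N)) ⟩
      toℕ y + N               ∎
      where open ≡-Reasoning

  toℕ-⊕1 : ∀ x → (toℕ (x ⊕ 1) ≡ suc (toℕ x)) ⊎ (toℕ x ≡ m × toℕ (x ⊕ 1) ≡ 0)
  toℕ-⊕1 x with ⊕-shiftsTo x 1 (s≤s z≤n)
  ... | inj₁ e = inj₁ (trans (sym e) (+-comm (toℕ x) 1))
  ... | inj₂ e = inj₂ (trans x≡y+m (cong (_+ m) y≡0) , y≡0)
    where
    y = toℕ (x ⊕ 1)
    x≡y+m : toℕ x ≡ y + m
    x≡y+m = suc-injective (trans (+-comm 1 (toℕ x)) (trans e (+-suc y m)))
    y≡0 : y ≡ 0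
    y≡0 = n≤0⇒n≡0 (+-cancelʳ-≤ m y 0 (≤-trans (≤-reflexive (sym x≡y+m)) (≤-pred (toℕ<n x))))

  toℕ-⊕m : ∀ x → (toℕ x ≡ suc (toℕ (x ⊕ m))) ⊎ (toℕ x ≡ 0 × toℕ (x ⊕ m) ≡ m)
  toℕ-⊕m x with ⊕-shiftsTo x m (n≤1+n m)
  ... | inj₂ e = inj₁ (+-cancelʳ-≡ m (toℕ x) (suc y) (trans e (+-suc y m)))
    where y = toℕ (x ⊕ m)
  ... | inj₁ e = inj₂ (x≡0 , trans (sym e) (cong (_+ m) x≡0))
    where
    x≡0 : toℕ x ≡ 0
    x≡0 = n≤0⇒n≡0 (+-cancelʳ-≤ m (toℕ x) 0 (≤-trans (≤-reflexive e) (≤-pred (toℕ<n (x ⊕ m)))))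

  Shift : ℕ → Fin N → Fin N → Set
  Shift k u v = ∃[ t ] (1 ≤ t × t ≤ k) × v ≡ u ⊕ t

  cycDist-⊕ : ∀ x t → t ≤ N → cycDist N x (x ⊕ t) ≤ t
  cycDist-⊕ x t t≤N = bound (⊕-shiftsTo x t t≤N)
    where
    a = toℕ x
    bound : ∀ {b} → ShiftsTo a t b → ∣ a - b ∣ ⊓ (N ∸ ∣ a - b ∣) ≤ t
    bound (inj₁ refl) rewrite m≤n⇒∣m-n∣≡n∸m (m≤m+n a t) | m+n∸m≡n a t = m⊓n≤m t (N ∸ t)
    bound {b} (inj₂ e) = begin
      ∣ a - b ∣ ⊓ (N ∸ ∣ a - b ∣)  ≡⟨ cong (λ z → z ⊓ (N ∸ z)) ∣a-b∣≡N∸t ⟩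
      (N ∸ t) ⊓ (N ∸ (N ∸ t))     ≡⟨ cong ((N ∸ t) ⊓_) (m∸[m∸n]≡n t≤N) ⟩
      (N ∸ t) ⊓ t                 ≤⟨ m⊓n≤n (N ∸ t) t ⟩
      t                           ∎
      where
      open ≤-Reasoning
      b≤a : b ≤ a
      b≤a = +-cancelʳ-≤ t b a (≤-trans (+-monoʳ-≤ b t≤N) (≤-reflexive (sym e)))
      ∣a-b∣≡N∸t : ∣ a - b ∣ ≡ N ∸ t
      ∣a-b∣≡N∸t = begin-equality
        ∣ a - b ∣          ≡⟨ m≤n⇒∣n-m∣≡n∸m b≤a ⟩
        a ∸ b              ≡⟨ [m+n]∸[m+o]≡n∸o t a b ⟨
        (t + a) ∸ (t + b)  ≡⟨ cong₂ _∸_ (trans (+-comm t a) e) (+-comm t b) ⟩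
        (b + N) ∸ (b + t)  ≡⟨ [m+n]∸[m+o]≡n∸o b N t ⟩
        N ∸ t              ∎

  module Power (k : ℕ) (k<N : k < N) where

    G : Graph
    G = CyclePower N k

    adjacent-sym : ∀ {u v} → Adjacent G u v → Adjacent G v u
    adjacent-sym = IsSimple.symmetric (cyclePower-isSimple N k)

    adjacent-⊕ : ∀ u {t} → 1 ≤ t → t ≤ k → Adjacent G u (u ⊕ t)
    adjacent-⊕ u 1≤t t≤k = adjacent⁺ (⊕-≢ u 1≤t (≤-<-trans t≤k k<N) ∘ sym)
                              (≤-trans (cycDist-⊕ u _ (≤-trans t≤k (<⇒≤ k<N))) t≤k)

    ordered-adjacent⇒shift : ∀ {u v} → toℕ u ≤ toℕ v → Adjacent G u v → Shift k u v ⊎ Shift k v u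
    ordered-adjacent⇒shift {u} {v} u≤v uv = by-minimum (⊓-sel d (N ∸ d))
      where
      d = toℕ v ∸ toℕ u
      d<N = ≤-<-trans (m∸n≤m (toℕ v) (toℕ u)) (toℕ<n v)
      dist≤k : d ⊓ (N ∸ d) ≤ k
      dist≤k = subst (λ z → z ⊓ (N ∸ z) ≤ k) (m≤n⇒∣m-n∣≡n∸m u≤v) (proj₂ (adjacent⁻ uv))
      wrap : toℕ v + (N ∸ d) ≡ toℕ u + N
      wrap = begin
        toℕ v + (N ∸ d)        ≡⟨ cong (_+ (N ∸ d)) (m+[n∸m]≡n u≤v) ⟨
        toℕ u + d + (N ∸ d)    ≡⟨ +-assoc (toℕ u) d (N ∸ d) ⟩
        toℕ u + (d + (N ∸ d))  ≡⟨ cong (toℕ u +_) (m+[n∸m]≡n (<⇒≤ d<N)) ⟩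
        toℕ u + N              ∎
        where open ≡-Reasoning
      by-minimum : (d ⊓ (N ∸ d) ≡ d) ⊎ (d ⊓ (N ∸ d) ≡ N ∸ d) → Shift k u v ⊎ Shift k v u
      by-minimum (inj₁ min≡d) =
        inj₁ (d , (0<d , subst (_≤ k) min≡d dist≤k) , sym (shiftsTo-⊕ u d v (inj₁ (m+[n∸m]≡n u≤v))))
        where 0<d = m<n⇒0<n∸m (≤∧≢⇒< u≤v (proj₁ (adjacent⁻ uv) ∘ toℕ-injective))
      by-minimum (inj₂ min≡N∸d) =
        inj₂ (N ∸ d , (m<n⇒0<n∸m d<N , subst (_≤ k) min≡N∸d dist≤k) , sym (shiftsTo-⊕ v (N ∸ d) u (inj₂ wrap)))

    adjacent⇒shift : ∀ {u v} → Adjacent G u v → Shift k u v ⊎ Shift k v u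
    adjacent⇒shift {u} {v} uv with ≤-total (toℕ u) (toℕ v)
    ... | inj₁ u≤v = ordered-adjacent⇒shift u≤v uv
    ... | inj₂ v≤u = swap (ordered-adjacent⇒shift v≤u (adjacent-sym uv))

    adjacent⇒shiftsTo : ∀ {u y} → Adjacent G u y →
                        ∃[ t ] (1 ≤ t × t ≤ k) × (ShiftsTo (toℕ u) t (toℕ y) ⊎ ShiftsTo (toℕ y) t (toℕ u))
    adjacent⇒shiftsTo uy with adjacent⇒shift uy
    ... | inj₁ (t , t-range , refl) = t , t-range , inj₁ (⊕-shiftsTo _ t (≤-trans (proj₂ t-range) (<⇒≤ k<N)))
    ... | inj₂ (t , t-range , refl) = t , t-range , inj₂ (⊕-shiftsTo _ t (≤-trans (proj₂ t-range) (<⇒≤ k<N)))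

    Close : ℕ → ℕ → Set
    Close i j = ∃[ t ] (1 ≤ t × t ≤ k) × ((j ≡ i + t) ⊎ (i ≡ j + t))

    close-adjacent : ∀ b {i j} → Close i j → Adjacent G (b ⊕ i) (b ⊕ j)
    close-adjacent b {i} (t , (1≤t , t≤k) , inj₁ refl) =
      subst (Adjacent G (b ⊕ i)) (⊕-assoc b i t) (adjacent-⊕ (b ⊕ i) 1≤t t≤k)
    close-adjacent b {j = j} (t , (1≤t , t≤k) , inj₂ refl) =
      adjacent-sym (subst (Adjacent G (b ⊕ j)) (⊕-assoc b j t) (adjacent-⊕ (b ⊕ j) 1≤t t≤k))

    close-offsets : ∀ b {i j} p q → Close p q → Close p i → Close p j → Close q i → Close q j →
                    AdjacentCommonNeighbours G (b ⊕ i) (b ⊕ j)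
    close-offsets b p q pq pi pj qi qj =
      b ⊕ p , b ⊕ q , close-adjacent b pq ,
      (close-adjacent b pi , close-adjacent b pj) , (close-adjacent b qi , close-adjacent b qj)

    same-position-nonadjacent : ∀ {u v} → toℕ u ≡ toℕ v → ¬ Adjacent G u v
    same-position-nonadjacent u≡v uv rewrite toℕ-injective u≡v = IsSimple.irreflexive (cyclePower-isSimple N k) uv

    ClosedNeighbour : Fin N → Fin N → Set
    ClosedNeighbour u z = (u ≡ z) ⊎ Adjacent G u z

    equal-or-adjacent : ∀ b {i j} → i ≤ j → j ≤ i + k → ClosedNeighbour (b ⊕ i) (b ⊕ j)
    equal-or-adjacent b {i} {j} i≤j j≤i+k with m≤n⇒m<n∨m≡n i≤j
    ... | inj₂ refl = inj₁ refl
    ... | inj₁ i<j  =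
      inj₂ (close-adjacent b (j ∸ i , (m<n⇒0<n∸m i<j , m≤n+o⇒m∸n≤o j i j≤i+k) , inj₁ (sym (m+[n∸m]≡n i≤j))))

    module Dense (3≤k : 3 ≤ k) (N<4k : N < (k + k) + (k + k)) where

      1≤k : 1 ≤ k
      1≤k = ≤-trans (s≤s z≤n) 3≤k

      2≤k : 2 ≤ k
      2≤k = ≤-trans (s≤s (s≤s z≤n)) 3≤k

      ahead : ∀ {i t} → 1 ≤ t → t ≤ k → Close i (i + t)
      ahead 1≤t t≤k = _ , (1≤t , t≤k) , inj₁ refl

      behind : ∀ {j t} → 1 ≤ t → t ≤ k → Close (j + t) j
      behind 1≤t t≤k = _ , (1≤t , t≤k) , inj₂ refl

      beyond-k : ∀ x {s} → 1 ≤ s → s < k → AdjacentCommonNeighbours G x (x ⊕ (k + s))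
      beyond-k x {s} 1≤s s<k = subst (λ z → AdjacentCommonNeighbours G z (x ⊕ (k + s))) (⊕-identityʳ x)
        (close-offsets x s (suc s) (1 , (≤-refl , 1≤k) , inj₁ (+-comm 1 s)) (behind {0} 1≤s (<⇒≤ s<k))
                       (subst (Close s) (+-comm s k) (ahead {s} 1≤k ≤-refl))
                       (behind {0} (s≤s z≤n) s<k)
                       (subst (Close (suc s)) (sym k+s≡1+s+[k-1]) (ahead {suc s} 1≤k-1 (m∸n≤m k 1))))
        where
        1≤k-1 : 1 ≤ k ∸ 1
        1≤k-1 = m<n⇒0<n∸m 2≤k
        k+s≡1+s+[k-1] : k + s ≡ suc s + (k ∸ 1)
        k+s≡1+s+[k-1] = begin
          k + s               ≡⟨ +-comm k s ⟩
          s + k               ≡⟨ cong (s +_) (m+[n∸m]≡n 1≤k) ⟨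
          s + suc (k ∸ 1)     ≡⟨ +-suc s (k ∸ 1) ⟩
          suc s + (k ∸ 1)     ∎
          where open ≡-Reasoning

      -- Witnesses: x + 1, x + 2 for d = 0 and 3 ≤ d ≤ k; x − 1, x + 2 for d = 1; x − 1, x + 1 for d = 2;
      -- x + s, x + s + 1 for d = k + s.
      short-distance : ∀ x d → d + d ≤ N → AdjacentCommonNeighbours G x (x ⊕ d)
      short-distance x 0 _ = subst (λ z → AdjacentCommonNeighbours G z (x ⊕ 0)) (⊕-identityʳ x)
        (close-offsets x 1 2 (ahead {1} ≤-refl 1≤k) (behind {0} ≤-refl 1≤k) (behind {0} ≤-refl 1≤k)
                             (behind {0} (s≤s z≤n) 2≤k) (behind {0} (s≤s z≤n) 2≤k))
      short-distance x 1 _ = subst₂ (AdjacentCommonNeighbours G) (trans (⊕-m-suc x 0) (⊕-identityʳ x)) (⊕-m-suc x 1)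
        (close-offsets (x ⊕ m) 3 0 (behind {0} (s≤s z≤n) 3≤k) (behind {1} (s≤s z≤n) 2≤k) (behind {2} ≤-refl 1≤k)
                                   (ahead {0} ≤-refl 1≤k) (ahead {0} (s≤s z≤n) 2≤k))
      short-distance x 2 _ = subst₂ (AdjacentCommonNeighbours G) (trans (⊕-m-suc x 0) (⊕-identityʳ x)) (⊕-m-suc x 2)
        (close-offsets (x ⊕ m) 2 0 (behind {0} (s≤s z≤n) 2≤k) (behind {1} ≤-refl 1≤k) (ahead {2} ≤-refl 1≤k)
                                   (ahead {0} ≤-refl 1≤k) (ahead {0} (s≤s z≤n) 3≤k))
      short-distance x d@(suc (suc (suc d′))) 2d≤N with d ≤? k
      ... | yes d≤k = subst (λ z → AdjacentCommonNeighbours G z (x ⊕ d)) (⊕-identityʳ x)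
        (close-offsets x 1 2 (ahead {1} ≤-refl 1≤k) (behind {0} ≤-refl 1≤k) (ahead {1} (s≤s z≤n) (≤-trans (m≤n+m _ 1) d≤k))
                             (behind {0} (s≤s z≤n) 2≤k) (ahead {2} (s≤s z≤n) (≤-trans (m≤n+m _ 2) d≤k)))
      ... | no d≰k = subst (AdjacentCommonNeighbours G x ∘ (x ⊕_)) (sym d≡k+s) (beyond-k x 1≤s s<k)
        where
        s = d ∸ k
        d≡k+s : d ≡ k + s
        d≡k+s = sym (m+[n∸m]≡n (<⇒≤ (≰⇒> d≰k)))
        1≤s : 1 ≤ s
        1≤s = m<n⇒0<n∸m (≰⇒> d≰k)
        s<k : s < k
        s<k = ≰⇒> λ k≤s → <⇒≱ N<4k (begin
          (k + k) + (k + k) ≤⟨ +-mono-≤ (+-monoʳ-≤ k k≤s) (+-monoʳ-≤ k k≤s) ⟩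
          (k + s) + (k + s) ≡⟨ cong₂ _+_ d≡k+s d≡k+s ⟨
          d + d             ≤⟨ 2d≤N ⟩
          N                 ∎)
          where open ≤-Reasoning

      adjacent-common-neighbours : ∀ x y → AdjacentCommonNeighbours G x y
      adjacent-common-neighbours x y with ⊕-surjective x y
      ... | d , d<N , refl with d + d ≤? N
      ...   | yes 2d≤N = short-distance x d 2d≤N
      ...   | no  2d≰N = adjacentCommonNeighbours-sym G
                           (subst (AdjacentCommonNeighbours G (x ⊕ d)) x⊕d⊕e≡x (short-distance (x ⊕ d) e 2e≤N))
        where
        e = N ∸ d
        d+e≡N : d + e ≡ N
        d+e≡N = m+[n∸m]≡n (<⇒≤ d<N)
        x⊕d⊕e≡x : x ⊕ d ⊕ e ≡ x
        x⊕d⊕e≡x = trans (⊕-assoc x d e) (trans (cong (x ⊕_) d+e≡N) (⊕-N x))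
        2e≤N : e + e ≤ N
        2e≤N with e ≤? d
        ... | yes e≤d = subst (e + e ≤_) (trans (+-comm e d) d+e≡N) (+-monoʳ-≤ e e≤d)
        ... | no  e≰d = ⊥-elim (2d≰N (subst (d + d ≤_) d+e≡N (+-monoʳ-≤ d (<⇒≤ (≰⇒> e≰d)))))

  module Sparse (k : ℕ) (2≤k : 2 ≤ k) (4k≤N : (k + k) + (k + k) ≤ N) where

    2k 3k : ℕ
    2k = k + k
    3k = k + 2k

    1≤k : 1 ≤ k
    1≤k = ≤-trans (s≤s z≤n) 2≤k

    3k<N : 3k < N
    3k<N = <-≤-trans (+-monoˡ-< 2k (m<m+n k 1≤k)) 4k≤N

    2k<m : 2k < m
    2k<m = ≤-pred (≤-trans (s≤s (m<n+m 2k 1≤k)) 3k<N)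

    2k<N : 2k < N
    2k<N = <-trans 2k<m (n<1+n m)

    open Power k (<-trans (m<m+n k 1≤k) 2k<N)

    -- The exponent rises from 0 at position 0 to its maximum at 2k, then falls, staying positive.
    exponent : ℕ → ℕ
    exponent zero = zero
    exponent a@(suc _) with a ≤? 2k
    ... | yes _ = N + a
    ... | no  _ = N ∸ a

    data Region (a : ℕ) : Set where
      origin     : a ≡ 0 → Region a
      ascending  : 1 ≤ a → a ≤ 2k → Region a
      descending : 2k < a → Region a

    region : ∀ a → Region a
    region zero = origin refl
    region a@(suc _) with a ≤? 2k
    ... | yes a≤2k = ascending (s≤s z≤n) a≤2k
    ... | no  a≰2k = descending (≰⇒> a≰2k)

    exponent-ascending : ∀ {a} → 1 ≤ a → a ≤ 2k → exponent a ≡ N + a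
    exponent-ascending {a@(suc _)} _ a≤2k with a ≤? 2k
    ... | yes _   = refl
    ... | no  a≰2k = ⊥-elim (a≰2k a≤2k)

    exponent-descending : ∀ {a} → 2k < a → exponent a ≡ N ∸ a
    exponent-descending {a@(suc _)} 2k<a with a ≤? 2k
    ... | yes a≤2k = ⊥-elim (<⇒≱ 2k<a a≤2k)
    ... | no  _    = refl

    exponent-ascent : ∀ {a} → a < 2k → exponent a < exponent (suc a)
    exponent-ascent {zero} 0<2k = subst (0 <_) (sym (exponent-ascending ≤-refl 0<2k)) (s≤s z≤n)
    exponent-ascent {a@(suc _)} a<2k = begin-strict
      exponent a        ≡⟨ exponent-ascending (s≤s z≤n) (<⇒≤ a<2k) ⟩
      N + a             <⟨ +-monoʳ-< N (n<1+n a) ⟩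
      N + suc a         ≡⟨ exponent-ascending (s≤s z≤n) a<2k ⟨
      exponent (suc a)  ∎
      where open ≤-Reasoning

    exponent-descent : ∀ {a} → 2k ≤ a → suc a < N → exponent (suc a) < exponent a
    exponent-descent {a} 2k≤a 1+a<N with m≤n⇒m<n∨m≡n 2k≤a
    ... | inj₁ 2k<a = begin-strict
      exponent (suc a)  ≡⟨ exponent-descending (≤-trans 2k<a (n≤1+n a)) ⟩
      N ∸ suc a         <⟨ ∸-monoʳ-< (n<1+n a) (<⇒≤ 1+a<N) ⟩
      N ∸ a             ≡⟨ exponent-descending 2k<a ⟨
      exponent a        ∎
      where open ≤-Reasoning
    ... | inj₂ refl = begin-strict
      exponent (suc 2k) ≡⟨ exponent-descending (n<1+n 2k) ⟩
      N ∸ suc 2k        ≤⟨ m∸n≤m N (suc 2k) ⟩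
      N                 <⟨ m<m+n N (≤-trans 1≤k (m≤m+n k k)) ⟩
      N + 2k            ≡⟨ exponent-ascending (≤-trans 1≤k (m≤m+n k k)) ≤-refl ⟨
      exponent 2k       ∎
      where open ≤-Reasoning

    exponent-wrap : exponent 0 < exponent m
    exponent-wrap = subst (0 <_) (sym (exponent-descending 2k<m)) (m<n⇒0<n∸m (n<1+n m))

    exponent-injective : ∀ {a b} → a < N → b < N → exponent a ≡ exponent b → a ≡ b
    exponent-injective {a} {b} a<N b<N eq with region a | region b
    ... | origin refl | origin refl = refl
    ... | ascending 1≤a a≤2k | ascending 1≤b b≤2k =
      +-cancelˡ-≡ N a b (trans (sym (exponent-ascending 1≤a a≤2k)) (trans eq (exponent-ascending 1≤b b≤2k)))
    ... | descending 2k<a | descending 2k<b =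
      ∸-cancelˡ-≡ (<⇒≤ a<N) (<⇒≤ b<N) (trans (sym (exponent-descending 2k<a)) (trans eq (exponent-descending 2k<b)))
    ... | origin refl | ascending 1≤b b≤2k =
      ⊥-elim (<⇒≢ (≤-trans (s≤s z≤n) (m≤m+n N b)) (trans eq (exponent-ascending 1≤b b≤2k)))
    ... | ascending 1≤a a≤2k | origin refl =
      ⊥-elim (<⇒≢ (≤-trans (s≤s z≤n) (m≤m+n N a)) (trans (sym eq) (exponent-ascending 1≤a a≤2k)))
    ... | origin refl | descending 2k<b = ⊥-elim (<⇒≢ (m<n⇒0<n∸m b<N) (trans eq (exponent-descending 2k<b)))
    ... | descending 2k<a | origin refl = ⊥-elim (<⇒≢ (m<n⇒0<n∸m a<N) (trans (sym eq) (exponent-descending 2k<a)))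
    ... | ascending 1≤a a≤2k | descending 2k<b = ⊥-elim (<-irrefl
          (trans (sym (exponent-descending 2k<b)) (trans (sym eq) (exponent-ascending 1≤a a≤2k)))
          (≤-<-trans (m∸n≤m N b) (m<m+n N 1≤a)))
    ... | descending 2k<a | ascending 1≤b b≤2k = ⊥-elim (<-irrefl
          (trans (sym (exponent-descending 2k<a)) (trans eq (exponent-ascending 1≤b b≤2k)))
          (≤-<-trans (m∸n≤m N a) (m<m+n N 1≤b)))

    exponent-≤ : ∀ a → exponent a ≤ N + N
    exponent-≤ a with region a
    ... | origin refl = z≤n
    ... | ascending 1≤a a≤2k =
      ≤-trans (≤-reflexive (exponent-ascending 1≤a a≤2k)) (+-monoʳ-≤ N (≤-trans a≤2k (<⇒≤ 2k<N)))
    ... | descending 2k<a = ≤-trans (≤-reflexive (exponent-descending 2k<a)) (≤-trans (m∸n≤m N a) (m≤m+n N N))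

    height : Fin N → ℕ
    height x = exponent (toℕ x)

    local-maximum-at-2k : ∀ X → height (X ⊕ 1) ≤ height X → height (X ⊕ m) ≤ height X → toℕ X ≡ 2k
    local-maximum-at-2k X right left = ≤-antisym at-most at-least
      where
      at-least : 2k ≤ toℕ X
      at-least with toℕ-⊕1 X
      ... | inj₂ (X≡m , _) = subst (2k ≤_) (sym X≡m) (<⇒≤ 2k<m)
      ... | inj₁ e with 2k ≤? toℕ X
      ...   | yes 2k≤X = 2k≤X
      ...   | no  2k≰X = ⊥-elim (<⇒≱ (subst (λ z → height X < exponent z) (sym e) (exponent-ascent (≰⇒> 2k≰X))) right)
      at-most : toℕ X ≤ 2k
      at-most with toℕ-⊕m X
      ... | inj₂ (X≡0 , _) = subst (_≤ 2k) (sym X≡0) z≤n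
      ... | inj₁ e with 2k ≤? toℕ (X ⊕ m)
      ...   | no  2k≰Y = subst (_≤ 2k) (sym e) (≰⇒> 2k≰Y)
      ...   | yes 2k≤Y = ⊥-elim (<⇒≱ (subst (λ z → exponent z < height (X ⊕ m)) (sym e)
                                         (exponent-descent 2k≤Y (subst (_< N) e (toℕ<n X)))) left)

    local-minimum-at-0 : ∀ B → height B ≤ height (B ⊕ 1) → height B ≤ height (B ⊕ m) → toℕ B ≡ 0
    local-minimum-at-0 B right left with toℕ-⊕m B
    ... | inj₂ (B≡0 , _) = B≡0
    ... | inj₁ e with 2k ≤? toℕ (B ⊕ m)
    ...   | no  2k≰Y =
      ⊥-elim (<⇒≱ (subst (λ z → height (B ⊕ m) < exponent z) (sym e) (exponent-ascent (≰⇒> 2k≰Y))) left)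
    ...   | yes 2k≤Y with toℕ-⊕1 B
    ...     | inj₁ e′ = ⊥-elim (<⇒≱ (subst (λ z → exponent z < height B) (sym e′)
                                       (exponent-descent 2k≤B (subst (_< N) e′ (toℕ<n (B ⊕ 1))))) right)
      where 2k≤B = subst (2k ≤_) (sym e) (≤-trans 2k≤Y (n≤1+n _))
    ...     | inj₂ (B≡m , B⊕1≡0) =
      ⊥-elim (<⇒≱ (subst₂ (λ z z′ → exponent z′ < exponent z) (sym B≡m) (sym B⊕1≡0) exponent-wrap) right)

    ≤2k<N : ∀ {t} → t ≤ 2k → t < N
    ≤2k<N t≤2k = ≤-<-trans t≤2k 2k<N

    ≤k<N : ∀ {t} → t ≤ k → t < N
    ≤k<N t≤k = ≤2k<N (≤-trans t≤k (m≤m+n k k))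

    2k+≤k≤3k : ∀ {t} → t ≤ k → 2k + t ≤ 3k
    2k+≤k≤3k t≤k = ≤-trans (+-monoʳ-≤ 2k t≤k) (≤-reflexive (+-comm 2k k))

    shiftsTo-origin : ∀ {a t} → a < N → 1 ≤ t → t ≤ k → ShiftsTo a t 0 ⊎ ShiftsTo 0 t a → a ≤ k ⊎ N ≤ a + k
    shiftsTo-origin {a} {t} _ 1≤t _ (inj₁ (inj₁ a+t≡0)) = ⊥-elim (<⇒≢ (≤-trans 1≤t (m≤n+m t a)) (sym a+t≡0))
    shiftsTo-origin {a} _ _ t≤k (inj₁ (inj₂ a+t≡N)) = inj₂ (subst (_≤ a + k) a+t≡N (+-monoʳ-≤ a t≤k))
    shiftsTo-origin _ _ t≤k (inj₂ (inj₁ refl)) = inj₁ t≤k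
    shiftsTo-origin {a} _ _ t≤k (inj₂ (inj₂ t≡a+N)) = ⊥-elim (<⇒≱ (≤k<N t≤k) (subst (N ≤_) (sym t≡a+N) (m≤n+m N a)))

    shiftsTo-2k : ∀ {a t} → a < N → 1 ≤ t → t ≤ k → ShiftsTo a t 2k ⊎ ShiftsTo 2k t a → k ≤ a × a ≤ 3k
    shiftsTo-2k {a} {t} _ _ t≤k (inj₁ (inj₁ a+t≡2k)) =
      +-cancelʳ-≤ t k a (≤-trans (+-monoʳ-≤ k t≤k) (≤-reflexive (sym a+t≡2k))) ,
      ≤-trans (≤-trans (m≤m+n a t) (≤-reflexive a+t≡2k)) (m≤n+m 2k k)
    shiftsTo-2k {a} {t} a<N _ t≤k (inj₁ (inj₂ a+t≡2k+N)) = ⊥-elim (<-irrefl a+t≡2k+N (begin-strict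
      a + t   <⟨ +-mono-<-≤ a<N t≤k ⟩
      N + k   ≤⟨ +-monoʳ-≤ N (m≤m+n k k) ⟩
      N + 2k  ≡⟨ +-comm N 2k ⟩
      2k + N  ∎))
      where open ≤-Reasoning
    shiftsTo-2k {t = t} _ _ t≤k (inj₂ (inj₁ refl)) = ≤-trans (m≤m+n k k) (m≤m+n 2k t) , 2k+≤k≤3k t≤k
    shiftsTo-2k {a} _ _ t≤k (inj₂ (inj₂ 2k+t≡a+N)) = ⊥-elim (<⇒≱ (≤-<-trans (2k+≤k≤3k t≤k) 3k<N)
                                                        (subst (N ≤_) (sym 2k+t≡a+N) (m≤n+m N a)))

    adjacent-to-origin : ∀ {u Q} → toℕ Q ≡ 0 → Adjacent G u Q → toℕ u ≤ k ⊎ N ≤ toℕ u + k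
    adjacent-to-origin {u} Q≡0 uQ with adjacent⇒shiftsTo uQ
    ... | t , (1≤t , t≤k) , shifts =
      shiftsTo-origin (toℕ<n u) 1≤t t≤k (subst (λ q → ShiftsTo (toℕ u) t q ⊎ ShiftsTo q t (toℕ u)) Q≡0 shifts)

    adjacent-to-2k : ∀ {u P} → toℕ P ≡ 2k → Adjacent G u P → k ≤ toℕ u × toℕ u ≤ 3k
    adjacent-to-2k {u} P≡2k uP with adjacent⇒shiftsTo uP
    ... | t , (1≤t , t≤k) , shifts =
      shiftsTo-2k (toℕ<n u) 1≤t t≤k (subst (λ p → ShiftsTo (toℕ u) t p ⊎ ShiftsTo p t (toℕ u)) P≡2k shifts)

    adjacent-to-origin-and-2k : ∀ {u P Q} → toℕ P ≡ 2k → toℕ Q ≡ 0 → Adjacent G u P → Adjacent G u Q →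
                                toℕ u ≡ k ⊎ (toℕ u ≡ 3k × N ≡ 2k + 2k)
    adjacent-to-origin-and-2k {u} P≡2k Q≡0 uP uQ with adjacent-to-2k P≡2k uP | adjacent-to-origin Q≡0 uQ
    ... | k≤u , u≤3k | inj₁ u≤k   = inj₁ (≤-antisym u≤k k≤u)
    ... | k≤u , u≤3k | inj₂ N≤u+k = inj₂ (≤-antisym u≤3k 3k≤u , ≤-antisym N≤4k 4k≤N)
      where
      4k≡3k+k : 2k + 2k ≡ 3k + k
      4k≡3k+k = trans (+-assoc k k 2k) (+-comm k 3k)
      3k≤u : 3k ≤ toℕ u
      3k≤u = +-cancelʳ-≤ k 3k (toℕ u) (≤-trans (≤-trans (≤-reflexive (sym 4k≡3k+k)) 4k≤N) N≤u+k)
      N≤4k : N ≤ 2k + 2k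
      N≤4k = ≤-trans N≤u+k (≤-trans (+-monoˡ-≤ k u≤3k) (≤-reflexive (sym 4k≡3k+k)))

    nonadjacent-k-3k : ∀ {x y} → toℕ x ≡ k → toℕ y ≡ 3k → N ≡ 2k + 2k → ¬ Adjacent G x y
    nonadjacent-k-3k {x} {y} x≡k y≡3k N≡4k xy =
      <⇒≱ (m<m+n k 1≤k) (subst (_≤ k) cycDist≡2k (proj₂ (adjacent⁻ xy)))
      where
      open ≡-Reasoning
      ∣x-y∣≡2k : ∣ toℕ x - toℕ y ∣ ≡ 2k
      ∣x-y∣≡2k = begin
        ∣ toℕ x - toℕ y ∣  ≡⟨ cong₂ ∣_-_∣ x≡k y≡3k ⟩
        ∣ k - 3k ∣         ≡⟨ m≤n⇒∣m-n∣≡n∸m (m≤m+n k 2k) ⟩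
        3k ∸ k             ≡⟨ m+n∸m≡n k 2k ⟩
        2k                 ∎
      cycDist≡2k : cycDist N x y ≡ 2k
      cycDist≡2k = begin
        ∣ toℕ x - toℕ y ∣ ⊓ (N ∸ ∣ toℕ x - toℕ y ∣) ≡⟨ cong (λ d → d ⊓ (N ∸ d)) ∣x-y∣≡2k ⟩
        2k ⊓ (N ∸ 2k)                              ≡⟨ cong (λ n → 2k ⊓ (n ∸ 2k)) N≡4k ⟩
        2k ⊓ (2k + 2k ∸ 2k)                        ≡⟨ cong (2k ⊓_) (m+n∸m≡n 2k 2k) ⟩
        2k ⊓ 2k                                    ≡⟨ ⊓-idem 2k ⟩
        2k                                         ∎

    -- Only positions k and (when N = 4k) 3k are adjacent to both 0 and 2k, and these are 2k apart.
    no-edge-adjacent-to-origin-and-2k : ∀ {u v P Q} → toℕ P ≡ 2k → toℕ Q ≡ 0 →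
      Adjacent G u P → Adjacent G u Q → Adjacent G v P → Adjacent G v Q → ¬ Adjacent G u v
    no-edge-adjacent-to-origin-and-2k P≡2k Q≡0 uP uQ vP vQ
      with adjacent-to-origin-and-2k P≡2k Q≡0 uP uQ | adjacent-to-origin-and-2k P≡2k Q≡0 vP vQ
    ... | inj₁ u≡k         | inj₁ v≡k         = same-position-nonadjacent (trans u≡k (sym v≡k))
    ... | inj₂ (u≡3k , _)  | inj₂ (v≡3k , _)  = same-position-nonadjacent (trans u≡3k (sym v≡3k))
    ... | inj₁ u≡k         | inj₂ (v≡3k , N≡4k) = nonadjacent-k-3k u≡k v≡3k N≡4k
    ... | inj₂ (u≡3k , N≡4k) | inj₁ v≡k       = nonadjacent-k-3k v≡k u≡3k N≡4k ∘ adjacent-sym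

    EdgeNeighbourhood : Fin N → Fin N → Fin N → Set
    EdgeNeighbourhood u v z = ClosedNeighbour u z ⊎ ClosedNeighbour v z

    closedNeighbour-sym : ∀ {a b} → ClosedNeighbour a b → ClosedNeighbour b a
    closedNeighbour-sym (inj₁ a≡b) = inj₁ (sym a≡b)
    closedNeighbour-sym (inj₂ ab)  = inj₂ (adjacent-sym ab)

    adjacent-⊕-suc : ∀ b {s} → suc s ≤ k → Adjacent G b (b ⊕ s ⊕ 1)
    adjacent-⊕-suc b {s} 1+s≤k =
      subst (Adjacent G b) (trans (cong (b ⊕_) (+-comm 1 s)) (sym (⊕-assoc b s 1))) (adjacent-⊕ b (s≤s z≤n) 1+s≤k)

    closedNeighbour-⊕-m : ∀ u {s} → 1 ≤ s → s ≤ k → ClosedNeighbour u (u ⊕ s ⊕ m)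
    closedNeighbour-⊕-m u {s} 1≤s s≤k = subst₂ ClosedNeighbour (trans (⊕-m-suc u 0) (⊕-identityʳ u)) (⊕-swap u m s)
                                          (equal-or-adjacent (u ⊕ m) 1≤s (≤-trans s≤k (n≤1+n k)))

    common-neighbour-±1-along : ∀ u {d X} → 1 ≤ d × d ≤ k → Adjacent G u X → Adjacent G (u ⊕ d) X →
                                EdgeNeighbourhood u (u ⊕ d) (X ⊕ 1) × EdgeNeighbourhood u (u ⊕ d) (X ⊕ m)
    common-neighbour-±1-along u {d} {X} (1≤d , d≤k) uX vX with adjacent⇒shift uX | adjacent⇒shift vX
    ... | inj₁ (s , (1≤s , s≤k) , refl) | inj₁ (s′ , (_ , s′≤k) , X≡v⊕s′) =
      inj₂ (inj₂ (subst (Adjacent G (u ⊕ d)) (cong (_⊕ 1) (sym X≡v⊕s′)) (adjacent-⊕-suc (u ⊕ d) 1+s′≤k))) ,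
      inj₁ (closedNeighbour-⊕-m u 1≤s s≤k)
      where
      s≡d+s′ : s ≡ d + s′
      s≡d+s′ = ⊕-cancelˡ u (≤k<N s≤k) (≤2k<N (+-mono-≤ d≤k s′≤k)) (trans X≡v⊕s′ (⊕-assoc u d s′))
      1+s′≤k : suc s′ ≤ k
      1+s′≤k = ≤-trans (+-monoˡ-≤ s′ 1≤d) (subst (_≤ k) s≡d+s′ s≤k)
    ... | inj₁ (s , (1≤s , s≤k) , refl) | inj₂ (s′ , (1≤s′ , s′≤k) , v≡X⊕s′) =
      inj₁ (inj₂ (adjacent-⊕-suc u 1+s≤k)) , inj₁ (closedNeighbour-⊕-m u 1≤s s≤k)
      where
      d≡s+s′ : d ≡ s + s′
      d≡s+s′ = ⊕-cancelˡ u (≤k<N d≤k) (≤2k<N (+-mono-≤ s≤k s′≤k)) (trans v≡X⊕s′ (⊕-assoc u s s′))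
      1+s≤k : suc s ≤ k
      1+s≤k = ≤-trans (≤-trans (≤-reflexive (+-comm 1 s)) (+-monoʳ-≤ s 1≤s′)) (subst (_≤ k) d≡s+s′ d≤k)
    ... | inj₂ (s , (1≤s , s≤k) , u≡X⊕s) | inj₁ (s′ , (_ , s′≤k) , refl) =
      ⊥-elim (⊕-≢ u (≤-trans 1≤d (m≤m+n d _)) (≤-<-trans (+-mono-≤ d≤k (+-mono-≤ s′≤k s≤k)) 3k<N)
        (sym (trans u≡X⊕s (trans (⊕-assoc (u ⊕ d) s′ s) (⊕-assoc u d (s′ + s))))))
    ... | inj₂ (s , (1≤s , s≤k) , refl) | inj₂ (s′ , (_ , s′≤k) , v≡X⊕s′) =
      inj₁ (closedNeighbour-sym (equal-or-adjacent X 1≤s (≤-trans s≤k (n≤1+n k)))) ,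
      inj₁ (inj₂ (adjacent-sym (subst (Adjacent G (X ⊕ m)) (⊕-m-suc X s) (adjacent-⊕ (X ⊕ m) (s≤s z≤n) 1+s≤k))))
      where
      s′≡s+d : s′ ≡ s + d
      s′≡s+d = ⊕-cancelˡ X (≤k<N s′≤k) (≤2k<N (+-mono-≤ s≤k d≤k)) (trans (sym v≡X⊕s′) (⊕-assoc X s d))
      1+s≤k : suc s ≤ k
      1+s≤k = ≤-trans (≤-trans (≤-reflexive (+-comm 1 s)) (+-monoʳ-≤ s 1≤d)) (subst (_≤ k) s′≡s+d s′≤k)

    common-neighbour-±1 : ∀ {u v X} → Adjacent G u v → Adjacent G u X → Adjacent G v X →
                          EdgeNeighbourhood u v (X ⊕ 1) × EdgeNeighbourhood u v (X ⊕ m)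
    common-neighbour-±1 uv uX vX with adjacent⇒shift uv
    ... | inj₁ (d , d-range , refl) = common-neighbour-±1-along _ d-range uX vX
    ... | inj₂ (d , d-range , refl) = flip (common-neighbour-±1-along _ d-range vX uX)
      where
      flip : ∀ {A B C D : Set} → (A ⊎ B) × (C ⊎ D) → (B ⊎ A) × (D ⊎ C)
      flip (p , q) = swap p , swap q

    height-injective : ∀ {x y} → height x ≡ height y → x ≡ y
    height-injective {x} {y} eq = toℕ-injective (exponent-injective (toℕ<n x) (toℕ<n y) eq)

    label : Fin N → ℕ
    label x = 2 ^ height x

    ⊕1≢⊕2 : ∀ w → w ⊕ 1 ≢ w ⊕ 2
    ⊕1≢⊕2 w eq with ⊕-cancelˡ w (≤k<N 1≤k) (≤k<N 2≤k) eq
    ... | ()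

    ⊕1∈nbrs : ∀ w → w ⊕ 1 ∈ nbrs G w
    ⊕1∈nbrs w = ∈-nbrs⁺ G (adjacent-⊕ w ≤-refl 1≤k)

    ⊕2∈nbrs : ∀ w → w ⊕ 2 ∈ nbrs G w
    ⊕2∈nbrs w = ∈-nbrs⁺ G (adjacent-⊕ w (s≤s z≤n) 2≤k)

    -- The neighbours w ⊕ 1 and w ⊕ 2 have different labels.
    minimum<maximum : ∀ w {X B} → Maximises label (nbrs G w) X → Minimises label (nbrs G w) B → height B < height X
    minimum<maximum w {X} {B} (_ , max) (_ , min) with label B <? label X
    ... | yes B<X = 2^-reflects-< B<X
    ... | no  B≮X =
      ⊥-elim (⊕1≢⊕2 w (height-injective (2^-injective (trans (squeezed (⊕1∈nbrs w)) (sym (squeezed (⊕2∈nbrs w)))))))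
      where
      squeezed : ∀ {y} → y ∈ nbrs G w → label y ≡ label X
      squeezed y∈ = ≤-antisym (max y∈) (≤-trans (≮⇒≥ B≮X) (min y∈))

    edgeNeighbourhood-all : ∀ {P : Fin N → Set} {u v z} → Adjacent G u v →
      (∀ {y} → y ∈ nbrs G u → P y) → (∀ {y} → y ∈ nbrs G v → P y) → EdgeNeighbourhood u v z → P z
    edgeNeighbourhood-all uv Pu Pv (inj₁ (inj₁ refl)) = Pv (∈-nbrs⁺ G (adjacent-sym uv))
    edgeNeighbourhood-all uv Pu Pv (inj₁ (inj₂ uz))   = Pu (∈-nbrs⁺ G uz)
    edgeNeighbourhood-all uv Pu Pv (inj₂ (inj₁ refl)) = Pu (∈-nbrs⁺ G uv)
    edgeNeighbourhood-all uv Pu Pv (inj₂ (inj₂ vz))   = Pv (∈-nbrs⁺ G vz)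

    -- X and B are local extrema of the height, hence at positions 2k and 0.
    common-extremes-impossible : ∀ {u v X B} → Adjacent G u v →
      Maximises label (nbrs G u) X → Maximises label (nbrs G v) X →
      Minimises label (nbrs G u) B → Minimises label (nbrs G v) B → ⊥
    common-extremes-impossible {u} {v} {X} {B} uv (X∈u , maxu) (X∈v , maxv) (B∈u , minu) (B∈v , minv) =
      no-edge-adjacent-to-origin-and-2k X≡2k B≡0
        (∈-nbrs⁻ G X∈u) (∈-nbrs⁻ G B∈u) (∈-nbrs⁻ G X∈v) (∈-nbrs⁻ G B∈v) uv
      where
      X±1 = common-neighbour-±1 uv (∈-nbrs⁻ G X∈u) (∈-nbrs⁻ G X∈v)
      B±1 = common-neighbour-±1 uv (∈-nbrs⁻ G B∈u) (∈-nbrs⁻ G B∈v)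
      below-X : ∀ {z} → EdgeNeighbourhood u v z → height z ≤ height X
      below-X = 2^-reflects-≤ ∘ edgeNeighbourhood-all uv maxu maxv
      above-B : ∀ {z} → EdgeNeighbourhood u v z → height B ≤ height z
      above-B = 2^-reflects-≤ ∘ edgeNeighbourhood-all uv minu minv
      X≡2k = local-maximum-at-2k X (below-X (proj₁ X±1)) (below-X (proj₂ X±1))
      B≡0  = local-minimum-at-0 B (above-B (proj₁ B±1)) (above-B (proj₂ B±1))

    gap-proper : ∀ {u v} → Adjacent G u v → gap G label u ≢ gap G label v
    gap-proper {u} {v} uv gap≡ with maximiser label _ (⊕1∈nbrs u) | minimiser label _ (⊕1∈nbrs u)
                                  | maximiser label _ (⊕1∈nbrs v) | minimiser label _ (⊕1∈nbrs v)
    ... | Xu , maxu | Bu , minu | Xv , maxv | Bv , minv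
      with 2^∸2^-injective (minimum<maximum u maxu minu) (minimum<maximum v maxv minv)
             (trans (sym (gap-at-extremes G label u maxu minu)) (trans gap≡ (gap-at-extremes G label v maxv minv)))
    ... | hX≡ , hB≡ with height-injective {Xu} {Xv} hX≡ | height-injective {Bu} {Bv} hB≡
    ... | refl | refl = common-extremes-impossible uv maxu maxv minu minv

    labelable : GapVertexLabelable G
    labelable = 2 ^ (N + N) , gapLabelling G _ label
      (λ w → 2≤deg G (adjacent-⊕ w ≤-refl 1≤k) (adjacent-⊕ w (s≤s z≤n) 2≤k) (⊕1≢⊕2 w))
      (λ v → m^n>0 2 (height v) , ^-monoʳ-≤ 2 (exponent-≤ (toℕ v)))
      gap-proper

-- Small cases and the characterisation

decided-labelable : ∀ G m π →
  T ⌊ all? (λ v → 2 ≤? deg G v) ×-dec all? (λ v → (1 ≤? π v) ×-dec (π v ≤? m))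
      ×-dec all? (λ u → all? λ v → T? (adj G u v) →-dec ¬? (gap G π u ≟ gap G π v)) ⌋ →
  GapVertexLabelable G
decided-labelable G m π ok with toWitness ok
... | 2≤deg , π-range , proper = m , gapLabelling G m π 2≤deg π-range λ uv → proper _ _ (isAdjacent uv)

C₆²-labelable : GapVertexLabelable (CyclePower 6 2)
C₆²-labelable = decided-labelable _ 5 (lookup (1 ∷ 2 ∷ 2 ∷ 1 ∷ 2 ∷ 4 ∷ [])) tt

C₇²-labelable : GapVertexLabelable (CyclePower 7 2)
C₇²-labelable = decided-labelable _ 5 (lookup (1 ∷ 2 ∷ 2 ∷ 2 ∷ 1 ∷ 3 ∷ 5 ∷ [])) tt

C₅²-not-labelable : ¬ GapVertexLabelable (CyclePower 5 2)
C₅²-not-labelable = ¬labelable-if-adjacent-common-neighbours _ (cyclePower-isSimple 5 2) (# 0)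
  (toWitness {a? = all? λ x → all? λ y → adjacentCommonNeighbours? (CyclePower 5 2) x y} tt)

Iso-refl : ∀ G → Iso G G
Iso-refl G = record { to = id ; from = id ; from-to = λ _ → refl ; to-from = λ _ → refl ; adj-pres = λ _ _ → refl }

Iso⇒≡V : ∀ {G H} → Iso G H → V G ≡ V H
Iso⇒≡V iso = ≤-antisym (injective⇒≤ (inverse-injective {f = to} {g = from} from-to))
                       (injective⇒≤ (inverse-injective {f = from} {g = to} to-from))
  where
  open Iso iso
  inverse-injective : ∀ {A B : Set} {f : A → B} {g : B → A} →
                      (∀ x → g (f x) ≡ x) → ∀ {x y} → f x ≡ f y → x ≡ y
  inverse-injective {g = g} gf {x} {y} fx≡fy = trans (sym (gf x)) (trans (cong g fx≡fy) (gf y))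

-- C₇³ is complete, while 0 and 3 are not adjacent in C₇².
C₇³≇C₇² : ¬ Iso (CyclePower 7 3) (CyclePower 7 2)
C₇³≇C₇² iso = subst₂ (λ u v → T (adj (CyclePower 7 2) u v)) (to-from (# 0)) (to-from (# 3))
  (subst T (sym (adj-pres (from (# 0)) (from (# 3)))) (complete _ _ from0≢from3))
  where
  open Iso iso
  complete : ∀ u v → u ≢ v → T (adj (CyclePower 7 3) u v)
  complete = toWitness {a? = all? λ u → all? λ v → ¬? (u ≟ᶠ v) →-dec T? (adj (CyclePower 7 3) u v)} tt
  from0≢from3 : from (# 0) ≢ from (# 3)
  from0≢from3 eq with trans (sym (to-from (# 0))) (trans (cong to eq) (to-from (# 3)))
  ... | ()

Characterisation : ℕ → ℕ → Set
Characterisation n k =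
  (Iso (CyclePower n k) (CyclePower 6 2) ⊎ Iso (CyclePower n k) (CyclePower 7 2)) ⊎ (8 ≤ n × k ≤ n / 4)

4k≡k*4 : ∀ k → (k + k) + (k + k) ≡ k * 4
4k≡k*4 = solve-∀

4k≤n⇔k≤n/4 : ∀ n k → (k + k) + (k + k) ≤ n ⇔ k ≤ n / 4
4k≤n⇔k≤n/4 n k = mk⇔
  (λ 4k≤n → ≤-trans (≤-reflexive (sym (m*n/n≡m k 4))) (/-monoˡ-≤ 4 (subst (_≤ n) (4k≡k*4 k) 4k≤n)))
  (λ k≤n/4 → subst (_≤ n) (sym (4k≡k*4 k)) (≤-trans (*-monoˡ-≤ 4 k≤n/4) (m/n*n≤m n 4)))

dense-not-labelable : ∀ m k → 3 ≤ k → k < suc m → suc m < (k + k) + (k + k) → ¬ GapVertexLabelable (CyclePower (suc m) k)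
dense-not-labelable m k 3≤k k<N N<4k = ¬labelable-if-adjacent-common-neighbours _ (cyclePower-isSimple _ k) (# 0)
  (Cycle.Power.Dense.adjacent-common-neighbours m k k<N 3≤k N<4k)

between-4-and-8 : ∀ {n} → 4 < n → n < 8 → n ≡ 5 ⊎ n ≡ 6 ⊎ n ≡ 7
between-4-and-8 {5} _ _ = inj₁ refl
between-4-and-8 {6} _ _ = inj₂ (inj₁ refl)
between-4-and-8 {7} _ _ = inj₂ (inj₂ refl)
between-4-and-8 {suc (suc (suc (suc (suc (suc (suc (suc _)))))))} _ (s≤s (s≤s (s≤s (s≤s (s≤s (s≤s (s≤s (s≤s ()))))))))
between-4-and-8 {1} (s≤s ()) _
between-4-and-8 {2} (s≤s (s≤s ())) _
between-4-and-8 {3} (s≤s (s≤s (s≤s ()))) _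
between-4-and-8 {4} (s≤s (s≤s (s≤s (s≤s ())))) _

two-or-three : ∀ {k} → 2 ≤ k → 2 * k < 7 → k ≡ 2 ⊎ k ≡ 3
two-or-three {1} (s≤s ()) _
two-or-three {2} _ _ = inj₁ refl
two-or-three {3} _ _ = inj₂ refl
two-or-three {suc (suc (suc (suc k)))} _ 2k<7 =
  ⊥-elim (<⇒≱ 2k<7 (≤-trans (n≤1+n 7) (+-mono-≤ (m≤m+n 4 k) (m≤m+n 4 (k + 0)))))

dense-labelable⇒exception : ∀ n k → 2 ≤ k → 2 * k < n → n < (k + k) + (k + k) → GapVertexLabelable (CyclePower n k) →
                            Iso (CyclePower n k) (CyclePower 6 2) ⊎ Iso (CyclePower n k) (CyclePower 7 2)
dense-labelable⇒exception (suc m) k@(suc (suc (suc _))) _ 2k<n n<4k lab =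
  ⊥-elim (dense-not-labelable m k (s≤s (s≤s (s≤s z≤n))) (≤-<-trans (m≤m+n k _) 2k<n) n<4k lab)
dense-labelable⇒exception n 1 (s≤s ()) _ _ _
dense-labelable⇒exception n 2 _ 4<n n<8 lab with between-4-and-8 4<n n<8
... | inj₁ refl        = ⊥-elim (C₅²-not-labelable lab)
... | inj₂ (inj₁ refl) = inj₁ (Iso-refl _)
... | inj₂ (inj₂ refl) = inj₂ (Iso-refl _)

labelable⇒characterisation : ∀ n k → 2 ≤ k → 2 * k < n → GapVertexLabelable (CyclePower n k) → Characterisation n k
labelable⇒characterisation n k 2≤k 2k<n lab with (k + k) + (k + k) ≤? n
... | yes 4k≤n =
  inj₂ (≤-trans (+-mono-≤ (+-mono-≤ 2≤k 2≤k) (+-mono-≤ 2≤k 2≤k)) 4k≤n , Equivalence.to (4k≤n⇔k≤n/4 n k) 4k≤n)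
... | no  4k≰n = inj₁ (dense-labelable⇒exception n k 2≤k 2k<n (≰⇒> 4k≰n) lab)

characterisation⇒labelable : ∀ n k → 2 ≤ k → 2 * k < n → Characterisation n k → GapVertexLabelable (CyclePower n k)
characterisation⇒labelable n k 2≤k 2k<n (inj₁ (inj₁ iso)) with Iso⇒≡V iso
... | refl with two-or-three 2≤k (≤-trans 2k<n (n≤1+n 6))
...   | inj₁ refl = C₆²-labelable
...   | inj₂ refl = ⊥-elim (<-irrefl refl 2k<n)
characterisation⇒labelable n k 2≤k 2k<n (inj₁ (inj₂ iso)) with Iso⇒≡V iso
... | refl with two-or-three 2≤k 2k<n
...   | inj₁ refl = C₇²-labelable
...   | inj₂ refl = ⊥-elim (C₇³≇C₇² iso)
characterisation⇒labelable (suc m) k 2≤k _ (inj₂ (_ , k≤n/4)) =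
  Cycle.Sparse.labelable m k 2≤k (Equivalence.from (4k≤n⇔k≤n/4 (suc m) k) k≤n/4)

-- The hypothesis 4 ≤ n follows from 2 ≤ k and 2k < n.
theorem6 : (n k : ℕ) → 4 ≤ n → 2 ≤ k → 2 * k < n →
  (GapVertexLabelable (CyclePower n k)
    ⇔ ((Iso (CyclePower n k) (CyclePower 6 2) ⊎ Iso (CyclePower n k) (CyclePower 7 2))
       ⊎ (8 ≤ n × k ≤ n / 4)))
theorem6 n k _ 2≤k 2k<n = mk⇔ (labelable⇒characterisation n k 2≤k 2k<n) (characterisation⇒labelable n k 2≤k 2k<n)
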